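{- The rule $I_\neg$ is derivable in $ALFA_{Io}$: for every graph $A$, $[A]\vdash_{ALFA_{Io}}\langle A\Rightarrow[\,]\rangle$.
   Context: Graphs: the empty graph $\emptyset$ and propositional letters are graphs; if $G,H$ are graphs then so are the juxtaposition $GH$, the cut $[G]$ ($G$ inside a solid closed curve), the implication graph $\langle G\Rightarrow H\rangle$ (a solid closed curve containing $G$ and a dotted closed curve containing $H$), and the disjunction graph $\langle G\vee H\rangle$ (a solid closed curve containing two semi-dotted closed curves, one containing $G$ and one containing $H$; $\langle G\vee H\rangle=\langle H\vee G\rangle$). Juxtaposition is associative and commutative with unit $\emptyset$; $[\,]$ is the empty cut. Rules are schemata with $A,B,C$ arbitrary (possibly empty) graphs, applied to the whole graph on the sheet. The system $ALFA_{Io}$ has first-degree rules $MP_i: A\langle A\Rightarrow B\rangle\vdash B$; $I_\vee: A\vdash\langle A\vee B\rangle$; $R_2: AB\vdash A$; $I_{p3}:\langle A\vee B\rangle\vdash\langle[A]\Rightarrow B\rangle$; $I_{p2}: [AB]\vdash\langle A\Rightarrow[B]\rangle$; $E_p:\langle A\Rightarrow B\rangle\vdash[A[B]]$; and second-degree rules $R_{8i}$: if $AB\vdash C$ then $A\vdash\langle B\Rightarrow C\rangle$; $R_0$: if $A\vdash B$ and $A\vdash C$ then $A\vdash BC$; $E_\vee$: if $A\vdash C$ and $B\vdash C$ then $\langle A\vee B\rangle\vdash C$. $\vdash_{ALFA_{Io}}$ is the least transitive relation on graphs containing all instances of the first-degree rules and closed under the second-degree rules. -}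

module Defs where

open import Data.Nat using (ℕ)

data Graph : Set where
  ∅     : Graph
  letter : ℕ → Graph
  _·_   : Graph → Graph → Graph      -- juxtaposition G H
  cut   : Graph → Graph              -- [G]
  ⟨_⇒_⟩ : Graph → Graph → Graph
  ⟨_∨_⟩ : Graph → Graph → Graph

infixl 6 _·_

emptyCut : Graph
emptyCut = cut ∅

data _≅_ : Graph → Graph → Set where
  ≅-refl  : ∀ {G} → G ≅ G
  ≅-sym   : ∀ {G H} → G ≅ H → H ≅ G
  ≅-trans : ∀ {G H K} → G ≅ H → H ≅ K → G ≅ K
  ·-assoc : ∀ {G H K} → ((G · H) · K) ≅ (G · (H · K))
  ·-comm  : ∀ {G H} → (G · H) ≅ (H · G)
  ·-unitˡ : ∀ {G} → (∅ · G) ≅ G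
  ∨-comm  : ∀ {G H} → ⟨ G ∨ H ⟩ ≅ ⟨ H ∨ G ⟩
  ·-cong  : ∀ {G G' H H'} → G ≅ G' → H ≅ H' → (G · H) ≅ (G' · H')
  cut-cong : ∀ {G G'} → G ≅ G' → cut G ≅ cut G'
  ⇒-cong  : ∀ {G G' H H'} → G ≅ G' → H ≅ H' → ⟨ G ⇒ H ⟩ ≅ ⟨ G' ⇒ H' ⟩
  ∨-cong  : ∀ {G G' H H'} → G ≅ G' → H ≅ H' → ⟨ G ∨ H ⟩ ≅ ⟨ G' ∨ H' ⟩

infix 4 _≅_ _⊢_

-- Derivability in ALFA_Io: least transitive relation containing all
-- instances of the first-degree rules (rules act on the whole sheet) and
-- closed under the second-degree rules.
data _⊢_ : Graph → Graph → Set where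
  ident : ∀ {G H} → G ≅ H → G ⊢ H
  trans : ∀ {G H K} → G ⊢ H → H ⊢ K → G ⊢ K
  MPᵢ  : ∀ {A B} → (A · ⟨ A ⇒ B ⟩) ⊢ B
  I∨   : ∀ {A B} → A ⊢ ⟨ A ∨ B ⟩
  R₂   : ∀ {A B} → (A · B) ⊢ A
  Ip3  : ∀ {A B} → ⟨ A ∨ B ⟩ ⊢ ⟨ cut A ⇒ B ⟩
  Ip2  : ∀ {A B} → cut (A · B) ⊢ ⟨ A ⇒ cut B ⟩
  Ep   : ∀ {A B} → ⟨ A ⇒ B ⟩ ⊢ cut (A · cut B)
  R8ᵢ  : ∀ {A B C} → (A · B) ⊢ C → A ⊢ ⟨ B ⇒ C ⟩
  R₀   : ∀ {A B C} → A ⊢ B → A ⊢ C → A ⊢ (B · C)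
  E∨   : ∀ {A B C} → A ⊢ C → B ⊢ C → ⟨ A ∨ B ⟩ ⊢ C

module Submission where

open import Defs

·-unitʳ : ∀ {G} → G ≅ G · ∅
·-unitʳ = ≅-sym (≅-trans ·-comm ·-unitˡ)

mainTheorem15 : (A : Graph) → cut A ⊢ ⟨ A ⇒ emptyCut ⟩
mainTheorem15 A = trans (ident (cut-cong ·-unitʳ)) (Ip2 {A} {∅})
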